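{- Let $P$ be an $R$-labeled poset of rank $n$ with fixed $R$-labeling $\lambda$, and let $T\subseteq\{1,\dots,n-1\}$. Then \[ \sum_{\ell\ge 0}\#\mathsf{B}^\circ_\ell(T)\ \ge\ \sum_{\ell\ge 0}\#\mathsf{B}^\circ_\ell(\emptyset). \]
   Context: A graded poset $P$ of rank $n$ is a finite poset with unique minimum $\hat 0$ (rank $0$) and unique maximum $\hat 1$ (rank $n$) such that ${\sf rank}(X)$ equals the length of every maximal chain from $\hat 0$ to $X$. A chain is a (possibly empty) totally ordered subset; ${\sf Rank}(\mathcal{C})=\{{\sf rank}(\mathcal{C}_i)\}$. An $R$-labeling is a map $\lambda$ from cover relations to positive integers such that every interval has a unique maximal chain with weakly increasing labels; $P$ is $R$-labeled if finite, graded and admitting one. For a chain $\mathcal{C}=\{\mathcal{C}_1<\dots<\mathcal{C}_k\}$, a multichain $\mathcal{D}=\{\{\mathcal{D}_1\le\dots\le\mathcal{D}_k\}\}$ interlaces $\mathcal{C}$ if $\mathcal{C}_1\le\mathcal{D}_1\le\mathcal{C}_2\le\dots\le\mathcal{C}_k\le\mathcal{D}_k$; $\mathsf{irank}(\mathcal{C},\mathcal{D})=\sum_i{\sf rank}(\mathcal{D}_i)-\sum_i{\sf rank}(\mathcal{C}_i)$. A maximal chain $\mathcal{M}=\{\mathcal{M}_0\lessdot\dots\lessdot\mathcal{M}_n\}$ decreases along $[\mathcal{M}_i,\mathcal{M}_j]$ if $\lambda(\mathcal{M}_i,\mathcal{M}_{i+1})>\dots>\lambda(\mathcal{M}_{j-1},\mathcal{M}_j)$,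 and weakly increases along it if these are weakly increasing. $\mathsf{IncDec}(\mathcal{C},\mathcal{D})$: maximal chains containing all $\mathcal{C}_i,\mathcal{D}_i$, decreasing along each $[\mathcal{C}_i,\mathcal{D}_i]$ and weakly increasing along $[\hat 0,\mathcal{C}_1]$, each $[\mathcal{D}_i,\mathcal{C}_{i+1}]$ and $[\mathcal{D}_k,\hat 1]$. For $S\subseteq\{0,\dots,n-1\}$, $\mathsf{A}_\ell(S)$ is the set of triples $(\mathcal{C},\mathcal{D},\mathcal{M})$ with $\mathcal{D}$ interlacing $\mathcal{C}$, ${\sf Rank}(\mathcal{C})=S$, $\mathsf{irank}(\mathcal{C},\mathcal{D})=\ell$, $\mathcal{M}\in\mathsf{IncDec}(\mathcal{C},\mathcal{D})$. For $S\subseteq T'$, $\varphi_{S,T'}(\mathcal{C},\mathcal{D},\mathcal{M})=(\mathcal{C}\cup\{\mathcal{M}_r:r\in T'\setminus S\},\mathcal{D}\sqcup\{\{\mathcal{M}_r:r\in T'\setminus S\}\},\mathcal{M})$, an injection $\mathsf{A}_\ell(S)\to\mathsf{A}_\ell(T')$. For $T\subseteq\{1,\dots,n-1\}$ set $\mathsf{B}^\circ_\ell(T)=\mathsf{A}_\ell(T\cup\{0\})\setminus\bigcup_{S\subsetneq T}\varphi_{S\cup\{0\},T\cup\{0\}}\big(\mathsf{A}_\ell(S\cup\{0\})\big)$. -}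

module Defs where

open import Data.Nat as ℕ using (ℕ; zero; suc; _+_; _∸_)
open import Data.Fin using (Fin; toℕ; inject₁)
open import Data.Fin.Subset using (Subset; _─_)
open import Data.Bool using (Bool; true; false; not; if_then_else_)
open import Data.List using (List; []; _∷_; map; length; take; drop; _++_; filterᵇ; allFin)
open import Data.Nat.ListAction using (sum)
open import Data.List.Relation.Unary.Linked using (Linked)
open import Data.List.Relation.Unary.All using (All)
open import Data.List.Membership.Propositional using (_∈_)
open import Data.List.Relation.Binary.Permutation.Propositional using (_↭_)
open import Data.Vec using (Vec; lookup; toList)
open import Data.Product using (Σ; _×_; _,_; ∃; ∃-syntax)
open import Data.Sum using (_⊎_)
open import Data.Unit using (⊤)
open import Data.Empty using (⊥)
open import Data.Refinement using (Refinement)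
open import Relation.Nullary using (¬_)
open import Relation.Binary.PropositionalEquality using (_≡_; _≢_)
open import Relation.Binary.Structures using (IsPartialOrder)
open import Function.Bundles using (_↔_)

record BoundedPoset : Set₁ where
  field
    N              : ℕ
    _≼_            : Fin N → Fin N → Set
    isPartialOrder : IsPartialOrder _≡_ _≼_
    𝟘 𝟙            : Fin N
    𝟘-min          : ∀ x → 𝟘 ≼ x
    𝟙-max          : ∀ x → x ≼ 𝟙

-- labels read off consecutive pairs of a chain (listed bottom to top)
labelsOf : ∀ {N} → (Fin N → Fin N → ℕ) → List (Fin N) → List ℕ
labelsOf lab (x ∷ y ∷ c) = lab x y ∷ labelsOf lab (y ∷ c)
labelsOf lab _           = []

WeaklyIncreasing : List ℕ → Set
WeaklyIncreasing = Linked ℕ._≤_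

StrictlyDecreasing : List ℕ → Set
StrictlyDecreasing = Linked ℕ._>_

module PosetDefs (P : BoundedPoset) where
  open BoundedPoset P public

  X : Set
  X = Fin N

  _≺_ : X → X → Set
  x ≺ y = x ≼ y × x ≢ y

  _⋖_ : X → X → Set
  x ⋖ y = x ≺ y × (∀ z → x ≺ z → z ≺ y → ⊥)

  -- Sat x c y : c = (x = c₀ ⋖ c₁ ⋖ … ⋖ cₖ = y), a maximal chain of [x,y]
  data Sat : X → List X → X → Set where
    sat-[] : ∀ {x} → Sat x (x ∷ []) x
    sat-∷  : ∀ {x y z c} → x ⋖ y → Sat y (y ∷ c) z → Sat x (x ∷ y ∷ c) z

record IsGraded (P : BoundedPoset) (rank : Fin (BoundedPoset.N P) → ℕ) : Set where
  open PosetDefs P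
  field
    rank-chain : ∀ x c → Sat 𝟘 c x → length c ≡ suc (rank x)

record IsRLabeling (P : BoundedPoset)
                   (lab : Fin (BoundedPoset.N P) → Fin (BoundedPoset.N P) → ℕ) : Set where
  open PosetDefs P
  field
    lab-pos   : ∀ x y → x ⋖ y → 1 ℕ.≤ lab x y
    unique-wi : ∀ x y → x ≼ y →
      Σ (List X) λ c → (Sat x c y × WeaklyIncreasing (labelsOf lab c))
        × (∀ c′ → Sat x c′ y → WeaklyIncreasing (labelsOf lab c′) → c′ ≡ c)

record RLabeledPoset : Set₁ where
  field
    poset   : BoundedPoset
  open BoundedPoset poset
  field
    rank    : Fin N → ℕ
    graded  : IsGraded poset rank
    lab     : Fin N → Fin N → ℕ
    rlabel  : IsRLabeling poset lab

HasCard : Set → ℕ → Set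
HasCard A k = Fin k ↔ A

interleave : ∀ {A : Set} → List A → List A → List A
interleave (c ∷ cs) (d ∷ ds) = c ∷ d ∷ interleave cs ds
interleave _        _        = []

members : ∀ {n} → Subset n → List (Fin n)
members {n} S = filterᵇ (λ i → lookup S i) (allFin n)

module Main (RP : RLabeledPoset) where
  open RLabeledPoset RP
  open PosetDefs poset public

  n : ℕ
  n = rank 𝟙

  -- triples (𝒞, 𝒟, ℳ): chain and multichain listed bottom to top,
  -- ℳ a list of n+1 elements (ℳ₀, …, ℳₙ)
  Triple : Set
  Triple = List X × List X × Vec X (suc n)

  segment : List X → ℕ → ℕ → List X
  segment M i j = take (suc j ∸ i) (drop i M)

  Alt : List X → Bool → List ℕ → Set
  Alt M b (i ∷ rest@(j ∷ _)) =
    (if b then WeaklyIncreasing (labelsOf lab (segment M i j))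
          else StrictlyDecreasing (labelsOf lab (segment M i j)))
    × Alt M (not b) rest
  Alt M b _ = ⊤

  IncDec : List X → List X → Vec X (suc n) → Set
  IncDec C D M =
    Sat 𝟘 (toList M) 𝟙
    × All (_∈ toList M) C × All (_∈ toList M) D
    × Alt (toList M) true (0 ∷ (interleave (map rank C) (map rank D) ++ (n ∷ [])))

  -- (𝒞,𝒟,ℳ) ∈ A_ℓ(S), S given as the increasing list of its elements
  InA : ℕ → List ℕ → Triple → Set
  InA ℓ S (C , D , M) =
    Linked _≺_ C
    × map rank C ≡ S
    × length C ≡ length D
    × Linked _≼_ (interleave C D)
    × sum (map rank D) ≡ ℓ + sum (map rank C)
    × IncDec C D M

  ranks₀ : Subset n → List ℕ
  ranks₀ S = 0 ∷ map toℕ (members S)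

  extra : Subset n → Subset n → Vec X (suc n) → List X
  extra S T M = map (λ r → lookup M (inject₁ r)) (members (T ─ S))

  Phi : Subset n → Subset n → Triple → Triple → Set
  Phi S T (C , D , M) (C′ , D′ , M′) =
    M′ ≡ M
    × (∀ z → (z ∈ C′ → z ∈ C ⊎ z ∈ extra S T M) × (z ∈ C ⊎ z ∈ extra S T M → z ∈ C′))
    × D′ ↭ (D ++ extra S T M)

  B° : ℕ → Subset n → Set
  B° ℓ T = Refinement Triple λ y →
    InA ℓ (ranks₀ T) y
    × ¬ (∃[ S ] (S Data.Fin.Subset.⊂ T × ∃[ x ] (InA ℓ (ranks₀ S) x × Phi S T x y)))

-- An element of B°_ℓ(∅) is a maximal chain ℳ whose labels strictly decrease along
-- [0̂, ℳ_ℓ] and weakly increase along [ℳ_ℓ, 1̂]: a chain together with a valley ℓ of its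
-- label sequence. Cut ℳ at the ranks {0} ∪ T and, in each gap [t, t′] between consecutive
-- cuts, turn where ℳ stops descending: at t′ − 1 below the valley, at t + 1 above it, and at
-- the valley in the gap containing it. This is an element of A(T ∪ {0}) with the same ℳ.
-- It is not φ_{S,T} of anything: deleting a cut ρ ∈ T needs a turn landing on ρ, a turn can
-- land on ρ only from the side matching the label step into ρ, and then ρ lies strictly
-- inside a segment of the smaller triple whose monotonicity contradicts that step. Two
-- valleys of one chain give different turns, so the construction is injective, and
-- comparing cardinalities level by level gives the inequality.

module Submission where

open import Data.Bool using (Bool; true; false; if_then_else_)
open import Data.Empty using (⊥-elim)
open import Data.Fin as Fin using (Fin; toℕ; inject₁)
open import Data.Fin.Properties using (+↔⊎; injective⇒≤; toℕ-inject₁; toℕ<n; toℕ-fromℕ<; toℕ-injective)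
open import Data.Fin.Subset using (Subset; _⊆_; _⊂_; _─_; _∉_; ⊥; inside; outside) renaming (_∈_ to _∈ˢ_)
open import Data.Fin.Subset.Properties using (drop-∷-⊆; x∈p∧x∉q⇒x∈p─q)
open import Data.Irrelevant using ([_])
open import Data.List using (List; []; _∷_; map; length; take; drop; _++_; applyUpTo; filterᵇ; tabulate)
open import Data.List.Membership.Propositional using (_∈_)
open import Data.List.Properties
  using (map-++; map-∘; map-cong; ∷-injectiveˡ; ∷-injectiveʳ; length-take; length-map)
  renaming (≡-dec to List-≡-dec)
open import Data.List.Relation.Binary.Permutation.Propositional using (_↭_; ↭-refl; ↭-sym; prep; ↭-trans)
open import Data.List.Relation.Binary.Permutation.Propositional.Properties using (map⁺; shift)
open import Data.List.Relation.Unary.All as All using (All; []; _∷_)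
open import Data.List.Relation.Unary.All.Properties
  using () renaming (map⁺ to All-map⁺; ++⁻ʳ to All++⁻ʳ; ++⁻ˡ to All++⁻ˡ; ++⁻ to All++⁻)
open import Data.List.Relation.Unary.Any using (here; there)
open import Data.List.Relation.Unary.Linked using (Linked; []; [-]; _∷_)
open import Data.List.Relation.Unary.Linked.Properties using (Linked⇒All)
open import Data.Nat using (ℕ; zero; suc; _+_; _∸_; _⊓_; _≤_; _<_; _>_; z≤n; s≤s; pred; _≟_; _<?_; _≤?_)
open import Data.Nat.ListAction using (sum)
open import Data.Nat.ListAction.Properties using (sum-++; sum-↭)
open import Data.Nat.Properties
open import Algebra.Properties.CommutativeSemigroup +-commutativeSemigroup
  using () renaming (interchange to +-interchange; xy∙z≈xz∙y to +-right-comm)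
open import Data.Product as Product using (Σ-syntax; ∃-syntax; _×_; _,_; proj₁; proj₂)
open import Data.Product.Properties using () renaming (≡-dec to ×-≡-dec)
open import Data.Refinement using (_,_; value; value-injective)
open import Data.Sum using (_⊎_; inj₁; inj₂)
open import Data.Sum.Function.Propositional using (_⊎-↔_)
open import Data.Vec using (Vec; lookup; toList) renaming ([] to []ᵛ; _∷_ to _∷ᵛ_)
open import Data.Vec.Base using (here; there)
open import Data.Vec.Properties using () renaming (≡-dec to Vec-≡-dec)
open import Function using (_∘_)
open import Function.Bundles using (_↔_; _↣_; Injection; mk↔ₛ′; mk↣)
open import Function.Properties.Injection using (↣-refl; ↣-trans)
open import Function.Properties.Inverse using (↔-trans; ↔-sym; ↔⇒↣)
open import Relation.Binary.Definitions using (tri<; tri≈; tri>)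
open import Relation.Binary.PropositionalEquality
  using (_≡_; _≢_; refl; sym; trans; cong; cong₂; subst; subst₂; ≢-sym; module ≡-Reasoning)
open import Relation.Binary.Structures using (IsPartialOrder)
open import Relation.Nullary using (Dec; does; ¬_; yes; no; _⊎-dec_; _×-dec_)
open import Relation.Nullary.Decidable using (dec-true; dec-false; recompute)

open import Defs

Σ-Fin-suc↔ : ∀ {P : ℕ → Set} {L : ℕ} →
  (Σ[ ℓ ∈ Fin (suc L) ] P (toℕ ℓ)) ↔ (P 0 ⊎ Σ[ ℓ ∈ Fin L ] P (suc (toℕ ℓ)))
Σ-Fin-suc↔ {P} {L} = mk↔ₛ′ split join split-join join-split
  where
  split : Σ[ ℓ ∈ Fin (suc L) ] P (toℕ ℓ) → P 0 ⊎ Σ[ ℓ ∈ Fin L ] P (suc (toℕ ℓ))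
  split (Fin.zero , x)  = inj₁ x
  split (Fin.suc ℓ , x) = inj₂ (ℓ , x)
  join : P 0 ⊎ Σ[ ℓ ∈ Fin L ] P (suc (toℕ ℓ)) → Σ[ ℓ ∈ Fin (suc L) ] P (toℕ ℓ)
  join (inj₁ x)       = Fin.zero , x
  join (inj₂ (ℓ , x)) = Fin.suc ℓ , x
  split-join : ∀ y → split (join y) ≡ y
  split-join (inj₁ _) = refl
  split-join (inj₂ _) = refl
  join-split : ∀ y → join (split y) ≡ y
  join-split (Fin.zero , _)  = refl
  join-split (Fin.suc _ , _) = refl

sum↔Σ : ∀ {A : ℕ → Set} (a : ℕ → ℕ) → (∀ ℓ → HasCard (A ℓ) (a ℓ)) →
  ∀ L → HasCard (Σ[ ℓ ∈ Fin L ] A (toℕ ℓ)) (sum (applyUpTo a L))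
sum↔Σ a card zero    = mk↔ₛ′ (λ ()) (λ ()) (λ ()) (λ ())
sum↔Σ {A} a card (suc L) =
  ↔-trans +↔⊎ (↔-trans (card 0 ⊎-↔ sum↔Σ (a ∘ suc) (card ∘ suc) L) (↔-sym (Σ-Fin-suc↔ {P = A})))

sum-≤-of-injection : ∀ {A B : ℕ → Set} {a b : ℕ → ℕ} {L L′} →
  (∀ ℓ → HasCard (A ℓ) (a ℓ)) → (∀ ℓ → HasCard (B ℓ) (b ℓ)) →
  (Σ[ ℓ ∈ Fin L ] A (toℕ ℓ)) ↣ (Σ[ ℓ ∈ Fin L′ ] B (toℕ ℓ)) →
  sum (applyUpTo a L) ≤ sum (applyUpTo b L′)
sum-≤-of-injection {a = a} {b} {L} {L′} cardA cardB g = injective⇒≤ (Injection.injective sums)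
  where
  sums : Fin (sum (applyUpTo a L)) ↣ Fin (sum (applyUpTo b L′))
  sums = ↣-trans (↔⇒↣ (sum↔Σ a cardA L)) (↣-trans g (↔⇒↣ (↔-sym (sum↔Σ b cardB L′))))

tally : (ℕ → ℕ) → List ℕ → ℕ
tally f xs = sum (map f xs)

module _ (f : ℕ → ℕ) where

  tally-++ : ∀ xs ys → tally f (xs ++ ys) ≡ tally f xs + tally f ys
  tally-++ xs ys = trans (cong sum (map-++ f xs ys)) (sum-++ (map f xs) (map f ys))

  tally-↭ : ∀ {xs ys} → xs ↭ ys → tally f xs ≡ tally f ys
  tally-↭ p = sum-↭ (map⁺ f p)

  tally-≡0 : ∀ {xs} → All (λ x → f x ≡ 0) xs → tally f xs ≡ 0
  tally-≡0 []       = refl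
  tally-≡0 (p ∷ ps) rewrite p = tally-≡0 ps

below : ℕ → ℕ → ℕ
below x e = if does (x <? e) then 1 else 0

equals : ℕ → ℕ → ℕ
equals x e = if does (x ≟ e) then 1 else 0

countBelow : ℕ → List ℕ → ℕ
countBelow e = tally (λ x → below x e)

countAt : ℕ → List ℕ → ℕ
countAt e = tally (λ x → equals x e)

below-< : ∀ {x e} → x < e → below x e ≡ 1
below-< {x} {e} x<e rewrite dec-true (x <? e) x<e = refl

below-≥ : ∀ {x e} → e ≤ x → below x e ≡ 0
below-≥ {x} {e} e≤x rewrite dec-false (x <? e) (≤⇒≯ e≤x) = refl

equals-refl : ∀ x → equals x x ≡ 1
equals-refl x rewrite dec-true (x ≟ x) refl = refl

equals-≢ : ∀ {x e} → x ≢ e → equals x e ≡ 0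
equals-≢ {x} {e} x≢e rewrite dec-false (x ≟ e) x≢e = refl

countBelow-≡0 : ∀ {e xs} → All (e ≤_) xs → countBelow e xs ≡ 0
countBelow-≡0 = tally-≡0 _ ∘ All.map below-≥

countAt-≡0 : ∀ {e xs} → All (e <_) xs → countAt e xs ≡ 0
countAt-≡0 = tally-≡0 _ ∘ All.map (λ e<x → equals-≢ (≢-sym (<⇒≢ e<x)))

countAt-∈ : ∀ {e xs} → e ∈ xs → 1 ≤ countAt e xs
countAt-∈ {e} (here refl) rewrite equals-refl e = s≤s z≤n
countAt-∈ {e} {x ∷ _} (there e∈xs) = ≤-trans (countAt-∈ e∈xs) (m≤n+m _ (equals x e))

positions : ∀ {m} → Subset m → ℕ → List ℕ
positions []ᵛ            k = []
positions (inside ∷ᵛ S)  k = k ∷ positions S (suc k)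
positions (outside ∷ᵛ S) k = positions S (suc k)

filter-tabulate : ∀ {m m′} (S : Subset m) (p : Fin m′ → Bool) (g : Fin m → Fin m′) k →
  (∀ i → p (g i) ≡ lookup S i) → (∀ i → toℕ (g i) ≡ k + toℕ i) →
  map toℕ (filterᵇ p (tabulate g)) ≡ positions S k
filter-tabulate []ᵛ p g k _ _ = refl
filter-tabulate (inside ∷ᵛ S) p g k hp hg with p (g Fin.zero) | hp Fin.zero
... | .inside | refl = cong₂ _∷_ (trans (hg Fin.zero) (+-identityʳ k))
  (filter-tabulate S p (g ∘ Fin.suc) (suc k) (hp ∘ Fin.suc) (λ i → trans (hg (Fin.suc i)) (+-suc k (toℕ i))))
filter-tabulate (outside ∷ᵛ S) p g k hp hg with p (g Fin.zero) | hp Fin.zero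
... | .outside | refl =
  filter-tabulate S p (g ∘ Fin.suc) (suc k) (hp ∘ Fin.suc) (λ i → trans (hg (Fin.suc i)) (+-suc k (toℕ i)))

members-positions : ∀ {m} (S : Subset m) → map toℕ (members S) ≡ positions S 0
members-positions S = filter-tabulate S (lookup S) (λ i → i) 0 (λ _ → refl) (λ _ → refl)

positions-≥ : ∀ {m} (S : Subset m) k → All (k ≤_) (positions S k)
positions-≥ []ᵛ            k = []
positions-≥ (inside ∷ᵛ S)  k = ≤-refl ∷ All.map (≤-trans (n≤1+n k)) (positions-≥ S (suc k))
positions-≥ (outside ∷ᵛ S) k = All.map (≤-trans (n≤1+n k)) (positions-≥ S (suc k))

positions-ascending : ∀ {m} (S : Subset m) {j k x} → j < k → k + m ≤ x →
  Linked _<_ (j ∷ positions S k ++ x ∷ [])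
positions-ascending []ᵛ {k = k} j<k k≤x = <-≤-trans j<k (subst (_≤ _) (+-identityʳ k) k≤x) ∷ [-]
positions-ascending {suc m} (inside ∷ᵛ S) {k = k} {x} j<k k+m≤x =
  j<k ∷ positions-ascending S (n<1+n k) (subst (_≤ x) (+-suc k m) k+m≤x)
positions-ascending {suc m} (outside ∷ᵛ S) {k = k} {x} j<k k+m≤x =
  positions-ascending S (m<n⇒m<1+n j<k) (subst (_≤ x) (+-suc k m) k+m≤x)

positions-ascending₀ : ∀ {m} (S : Subset m) → 0 < m → (∀ i → toℕ i ≡ 0 → i ∉ S) →
  Linked _<_ (0 ∷ positions S 0 ++ m ∷ [])
positions-ascending₀ (inside ∷ᵛ S) _ S₀ = ⊥-elim (S₀ Fin.zero refl here)
positions-ascending₀ (outside ∷ᵛ S) _ _ = positions-ascending S (s≤s z≤n) ≤-refl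

positions-∈ : ∀ {m} (S : Subset m) k {r} → r ∈ˢ S → k + toℕ r ∈ positions S k
positions-∈ (inside ∷ᵛ S) k here = here (+-identityʳ k)
positions-∈ (inside ∷ᵛ S) k {Fin.suc r} (there r∈S) =
  there (subst (_∈ positions S (suc k)) (sym (+-suc k (toℕ r))) (positions-∈ S (suc k) r∈S))
positions-∈ (outside ∷ᵛ S) k {Fin.suc r} (there r∈S) =
  subst (_∈ positions S (suc k)) (sym (+-suc k (toℕ r))) (positions-∈ S (suc k) r∈S)

positions-∉ : ∀ {m} (S : Subset m) k {r} → r ∉ S → ¬ k + toℕ r ∈ positions S k
positions-∉ (inside ∷ᵛ S)  k {Fin.zero} r∉S _ = r∉S here
positions-∉ (outside ∷ᵛ S) k {Fin.zero} _ k∈ =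
  1+n≰n (subst (suc k ≤_) (+-identityʳ k) (All.lookup (positions-≥ S (suc k)) k∈))
positions-∉ (inside ∷ᵛ S)  k {Fin.suc r} _ (here k+r≡k) = m+1+n≢m k (k+r≡k)
positions-∉ (inside ∷ᵛ S)  k {Fin.suc r} r∉S (there k+r∈) =
  positions-∉ S (suc k) (r∉S ∘ there) (subst (_∈ positions S (suc k)) (+-suc k (toℕ r)) k+r∈)
positions-∉ (outside ∷ᵛ S) k {Fin.suc r} r∉S k+r∈ =
  positions-∉ S (suc k) (r∉S ∘ there) (subst (_∈ positions S (suc k)) (+-suc k (toℕ r)) k+r∈)

positions-─ : ∀ {m} {S T : Subset m} → S ⊆ T → ∀ k →
  positions T k ↭ positions S k ++ positions (T ─ S) k
positions-─ {S = []ᵛ} {[]ᵛ} _ k = ↭-refl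
positions-─ {S = inside ∷ᵛ S} {inside ∷ᵛ T} S⊆T k = prep k (positions-─ (drop-∷-⊆ S⊆T) (suc k))
positions-─ {S = inside ∷ᵛ S} {outside ∷ᵛ T} S⊆T k with S⊆T here
... | ()
positions-─ {S = outside ∷ᵛ S} {inside ∷ᵛ T} S⊆T k =
  ↭-trans (prep k (positions-─ (drop-∷-⊆ S⊆T) (suc k))) (↭-sym (shift k (positions S (suc k)) _))
positions-─ {S = outside ∷ᵛ S} {outside ∷ᵛ T} S⊆T k = positions-─ (drop-∷-⊆ S⊆T) (suc k)

Subset-0≡⊥ : ∀ {m} (U : Subset m) → m ≡ 0 → U ≡ ⊥
Subset-0≡⊥ []ᵛ refl = refl

positions-⊥ : ∀ {m} k → positions (⊥ {m}) k ≡ []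
positions-⊥ {zero}  k = refl
positions-⊥ {suc m} k = positions-⊥ {m} (suc k)

module _ {A : Set} where

  interleave-map : ∀ {B : Set} (f : A → B) xs ys → interleave (map f xs) (map f ys) ≡ map f (interleave xs ys)
  interleave-map f []       _        = refl
  interleave-map f (_ ∷ _)  []       = refl
  interleave-map f (x ∷ xs) (y ∷ ys) = cong (λ zs → f x ∷ f y ∷ zs) (interleave-map f xs ys)

  module _ {P : A → Set} where

    All-interleave⁺ : ∀ {xs ys} → All P xs → All P ys → All P (interleave xs ys)
    All-interleave⁺ []       _        = []
    All-interleave⁺ (_ ∷ _)  []       = []
    All-interleave⁺ (p ∷ ps) (q ∷ qs) = p ∷ q ∷ All-interleave⁺ ps qs

    All-interleave⁻ : ∀ xs ys → length xs ≡ length ys → All P (interleave xs ys) → All P xs × All P ys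
    All-interleave⁻ []       []       _   _             = [] , []
    All-interleave⁻ (_ ∷ xs) (_ ∷ ys) len (p ∷ q ∷ pqs) with All-interleave⁻ xs ys (suc-injective len) pqs
    ... | ps , qs = p ∷ ps , q ∷ qs

interleave-above : ∀ {x n} cs ds → length cs ≡ length ds → Linked _≤_ (x ∷ interleave cs ds ++ n ∷ []) →
  All (x ≤_) cs × All (x ≤_) ds × x ≤ n
interleave-above {x} cs ds len sorted
  with All++⁻ (interleave cs ds) (All.tail (Linked⇒All ≤-trans (≤-refl {x}) sorted))
... | above , x≤n ∷ [] = Product.map₂ (_, x≤n) (All-interleave⁻ cs ds len above)

Linked-init : ∀ {R : ℕ → ℕ → Set} xs {y} → Linked R (xs ++ y ∷ []) → Linked R xs
Linked-init []           _         = []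
Linked-init (_ ∷ [])     _         = [-]
Linked-init (_ ∷ x ∷ xs) (r ∷ rs) = r ∷ Linked-init (x ∷ xs) rs

Linked-≤-last : ∀ {n} xs → Linked _≤_ (xs ++ n ∷ []) → All (_≤ n) xs
Linked-≤-last []           _              = []
Linked-≤-last (x ∷ [])     (x≤n ∷ _)      = x≤n ∷ []
Linked-≤-last (x ∷ y ∷ xs) (x≤y ∷ sorted) with Linked-≤-last (y ∷ xs) sorted
... | y≤n ∷ bounds = ≤-trans x≤y y≤n ∷ y≤n ∷ bounds

Linked-bracket : ∀ {n zs} → Linked _≤_ zs → All (_≤ n) zs → Linked _≤_ (0 ∷ zs ++ n ∷ [])
Linked-bracket {zs = []}     _              _            = z≤n ∷ [-]
Linked-bracket {zs = _ ∷ []} _              (z≤n′ ∷ [])  = z≤n ∷ z≤n′ ∷ [-]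
Linked-bracket {zs = _ ∷ _ ∷ _} (r ∷ rs) (_ ∷ bs) with Linked-bracket rs bs
... | _ ∷ rest = z≤n ∷ r ∷ rest

nth : ∀ {A : Set} → A → List A → ℕ → A
nth d []       _       = d
nth d (x ∷ xs) zero    = x
nth d (x ∷ xs) (suc i) = nth d xs i

lookup-nth : ∀ {A : Set} {m} (d : A) (xs : Vec A m) i → lookup xs i ≡ nth d (toList xs) (toℕ i)
lookup-nth d (x ∷ᵛ xs) Fin.zero    = refl
lookup-nth d (x ∷ᵛ xs) (Fin.suc i) = lookup-nth d xs i

LinkedOn : (ℕ → ℕ → Set) → (ℕ → ℕ) → ℕ → ℕ → Set
LinkedOn R f i j = ∀ e → i ≤ e → suc (suc e) ≤ j → R (f e) (f (suc e))

module _ {N : ℕ} (d : Fin N) (lab : Fin N → Fin N → ℕ) where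

  stepLabel : List (Fin N) → ℕ → ℕ
  stepLabel xs e = lab (nth d xs e) (nth d xs (suc e))

  private variable R : ℕ → ℕ → Set

  linked-prefix⇒ : ∀ xs j → j < length xs →
    Linked R (labelsOf lab (take (suc j) xs)) → LinkedOn R (stepLabel xs) 0 j
  linked-prefix⇒ _ zero _ _ _ _ ()
  linked-prefix⇒ _ (suc zero) _ _ _ _ (s≤s ())
  linked-prefix⇒ (_ ∷ _ ∷ _ ∷ _) (suc (suc j)) _ (r ∷ _) zero _ _ = r
  linked-prefix⇒ (_ ∷ y ∷ z ∷ xs) (suc (suc j)) (s≤s j<) (_ ∷ l) (suc e) _ (s≤s e+2≤) =
    linked-prefix⇒ (y ∷ z ∷ xs) (suc j) j< l e z≤n e+2≤
  linked-prefix⇒ (_ ∷ _ ∷ []) (suc (suc j)) (s≤s (s≤s ())) _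
  linked-prefix⇒ (_ ∷ []) (suc (suc j)) (s≤s ()) _
  linked-prefix⇒ [] (suc (suc j)) () _

  linked-prefix⇐ : ∀ xs j → j < length xs →
    LinkedOn R (stepLabel xs) 0 j → Linked R (labelsOf lab (take (suc j) xs))
  linked-prefix⇐ (_ ∷ _) zero _ _ = []
  linked-prefix⇐ (_ ∷ _ ∷ _) (suc zero) _ _ = [-]
  linked-prefix⇐ (_ ∷ y ∷ z ∷ xs) (suc (suc j)) (s≤s j<) h =
    h 0 z≤n (s≤s (s≤s z≤n)) ∷ linked-prefix⇐ (y ∷ z ∷ xs) (suc j) j< (λ e _ e+2≤ → h (suc e) z≤n (s≤s e+2≤))
  linked-prefix⇐ (_ ∷ []) (suc zero) (s≤s ()) _
  linked-prefix⇐ (_ ∷ _ ∷ []) (suc (suc j)) (s≤s (s≤s ())) _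
  linked-prefix⇐ (_ ∷ []) (suc (suc j)) (s≤s ()) _

  linked-segment⇒ : ∀ xs i j → i ≤ j → j < length xs →
    Linked R (labelsOf lab (take (suc j ∸ i) (drop i xs))) → LinkedOn R (stepLabel xs) i j
  linked-segment⇒ xs zero j _ j< l = linked-prefix⇒ xs j j< l
  linked-segment⇒ (_ ∷ xs) (suc i) (suc j) (s≤s i≤j) (s≤s j<) l (suc e) (s≤s i≤e) e+2≤ =
    linked-segment⇒ xs i j i≤j j< l e i≤e (≤-pred e+2≤)

  linked-segment⇐ : ∀ xs i j → i ≤ j → j < length xs →
    LinkedOn R (stepLabel xs) i j → Linked R (labelsOf lab (take (suc j ∸ i) (drop i xs)))
  linked-segment⇐ xs zero j _ j< h = linked-prefix⇐ xs j j< h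
  linked-segment⇐ (_ ∷ xs) (suc i) (suc j) (s≤s i≤j) (s≤s j<) h =
    linked-segment⇐ xs i j i≤j j< (λ e i≤e e+2≤ → h (suc e) (s≤s i≤e) (s≤s e+2≤))

-- Valleys and thresholds

record Valley (n : ℕ) (f : ℕ → ℕ) (v : ℕ) : Set where
  field
    v≤n     : v ≤ n
    descent : LinkedOn _>_ f 0 v
    ascent  : LinkedOn _≤_ f v n

AscentInto : ℕ → (ℕ → ℕ) → ℕ → Set
AscentInto n f v = v ≡ n ⊎ (0 < v × f (pred v) ≤ f v)

ascentInto? : ∀ n f v → Dec (AscentInto n f v)
ascentInto? n f v = v ≟ n ⊎-dec 0 <? v ×-dec f (pred v) ≤? f v

-- If v is itself a cut, the gap containing the threshold is the one on the side of v
-- matching the label step into v: the left gap for an ascent, the right gap for a descent.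
threshold : ℕ → (ℕ → ℕ) → ℕ → ℕ
threshold n f v with ascentInto? n f v
... | yes _ = v
... | no _  = suc v

data ThresholdView (n : ℕ) (f : ℕ → ℕ) (v : ℕ) : ℕ → Set where
  at-valley    : AscentInto n f v → ThresholdView n f v v
  after-valley : ¬ AscentInto n f v → ThresholdView n f v (suc v)

threshold-view : ∀ n f v → ThresholdView n f v (threshold n f v)
threshold-view n f v with ascentInto? n f v
... | yes asc = at-valley asc
... | no ¬asc = after-valley ¬asc

module _ (n : ℕ) (f : ℕ → ℕ) (v : ℕ) where

  threshold-≥ : v ≤ threshold n f v
  threshold-≥ with threshold n f v | threshold-view n f v
  ... | _ | at-valley _    = ≤-refl
  ... | _ | after-valley _ = n≤1+n v

  threshold-≤ : threshold n f v ≤ suc v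
  threshold-≤ with threshold n f v | threshold-view n f v
  ... | _ | at-valley _    = n≤1+n v
  ... | _ | after-valley _ = ≤-refl

  threshold-ascent : threshold n f v ≤ v → v < n → f (pred v) ≤ f v
  threshold-ascent with threshold n f v | threshold-view n f v
  ... | _ | at-valley (inj₁ v≡n)      = λ _ v<n → ⊥-elim (<⇒≢ v<n v≡n)
  ... | _ | at-valley (inj₂ (_ , le)) = λ _ _ → le
  ... | _ | after-valley _            = λ v+1≤v → ⊥-elim (1+n≰n v+1≤v)

  threshold-descent : v < threshold n f v → 0 < v → f v < f (pred v)
  threshold-descent with threshold n f v | threshold-view n f v
  ... | _ | at-valley _       = λ v<v → ⊥-elim (<-irrefl refl v<v)
  ... | _ | after-valley ¬asc = λ _ 0<v → ≰⇒> (λ le → ¬asc (inj₂ (0<v , le)))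

∸-telescope : ∀ {t t′ n} → t ≤ t′ → t′ ≤ n → (t′ ∸ t) + (n ∸ t′) ≡ n ∸ t
∸-telescope z≤n t′≤n = m+[n∸m]≡n t′≤n
∸-telescope (s≤s t≤t′) (s≤s t′≤n) = ∸-telescope t≤t′ t′≤n

-- Along a fixed maximal chain, 𝒞 and 𝒟 are given by the ranks of their elements: the
-- cuts t₀ = 0 < t₁ < ⋯ < t_k and the turns d_i ∈ [t_i, t_{i+1}], where t_{k+1} = n.
module Cuts (n : ℕ) where

  Ascending : ℕ → List ℕ → Set
  Ascending t ts = Linked _<_ (t ∷ ts ++ n ∷ [])

  next : List ℕ → ℕ
  next []      = n
  next (t ∷ _) = t

  ascending-next : ∀ {t ts} → Ascending t ts → t < next ts
  ascending-next {ts = []}    (t<n ∷ _)  = t<n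
  ascending-next {ts = _ ∷ _} (t<t′ ∷ _) = t<t′

  ascending-all : ∀ {t ts} → Ascending t ts → All (t <_) (ts ++ n ∷ [])
  ascending-all {ts = []}    (t<n ∷ l)  = Linked⇒All <-trans t<n l
  ascending-all {ts = _ ∷ _} (t<t′ ∷ l) = Linked⇒All <-trans t<t′ l

  ascending-<n : ∀ {t ts} → Ascending t ts → t < n
  ascending-<n {ts = ts} asc with All++⁻ʳ ts (ascending-all asc)
  ... | t<n ∷ [] = t<n

  next≤n : ∀ {t ts} → Ascending t ts → next ts ≤ n
  next≤n {ts = []}    _         = ≤-refl
  next≤n {ts = _ ∷ _} (_ ∷ asc) = <⇒≤ (ascending-<n asc)

module Turns (n v w : ℕ) where
  open Cuts n public

  turn : ℕ → ℕ → ℕ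
  turn t t′ with t′ <? w | w ≤? t
  ... | yes _ | _     = pred t′
  ... | no _  | yes _ = suc t
  ... | no _  | no _  = v

  data TurnView (t t′ : ℕ) : ℕ → Set where
    descending-gap : t′ < w → TurnView t t′ (pred t′)
    ascending-gap  : w ≤ t → w ≤ t′ → TurnView t t′ (suc t)
    valley-gap     : t < w → w ≤ t′ → TurnView t t′ v

  turn-view : ∀ t t′ → TurnView t t′ (turn t t′)
  turn-view t t′ with t′ <? w | w ≤? t
  ... | yes t′<w | _       = descending-gap t′<w
  ... | no t′≮w  | yes w≤t = ascending-gap w≤t (≮⇒≥ t′≮w)
  ... | no t′≮w  | no w≰t  = valley-gap (≰⇒> w≰t) (≮⇒≥ t′≮w)

  turns : ℕ → List ℕ → List ℕ
  turnsFrom : List ℕ → List ℕ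
  turns t ts = turn t (next ts) ∷ turnsFrom ts
  turnsFrom []       = []
  turnsFrom (t ∷ ts) = turns t ts

  excess : ℕ → List ℕ → ℕ
  excess t []        = turn t n ∸ t
  excess t (t′ ∷ ts) = (turn t t′ ∸ t) + excess t′ ts

  turns-length : ∀ t ts → length (turns t ts) ≡ length (t ∷ ts)
  turns-length t []        = refl
  turns-length t (t′ ∷ ts) = cong suc (turns-length t′ ts)

  turn-valley : ∀ {t t′} → t < w → w ≤ t′ → turn t t′ ≡ v
  turn-valley {t} {t′} t<w w≤t′ with turn t t′ | turn-view t t′
  ... | _ | descending-gap t′<w = ⊥-elim (<⇒≱ t′<w w≤t′)
  ... | _ | ascending-gap w≤t _ = ⊥-elim (<⇒≱ t<w w≤t)
  ... | _ | valley-gap _ _      = refl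

  module Bounded (v≤w : v ≤ w) (w≤1+v : w ≤ suc v) where

    turn-between : ∀ {t t′} → t < t′ → t ≤ turn t t′ × turn t t′ ≤ t′
    turn-between {t} {t′} t<t′ with turn t t′ | turn-view t t′
    ... | _ | descending-gap _   = <⇒≤pred t<t′ , pred[n]≤n
    ... | _ | ascending-gap _ _  = n≤1+n t , t<t′
    ... | _ | valley-gap t<w w≤t′ = ≤-pred (≤-trans t<w w≤1+v) , ≤-trans v≤w w≤t′

    turns-interleave-sorted : ∀ t ts → Ascending t ts →
      Linked _≤_ (interleave (t ∷ ts) (turns t ts) ++ n ∷ [])
    turns-interleave-sorted t [] (t<n ∷ _) = proj₁ (turn-between t<n) ∷ proj₂ (turn-between t<n) ∷ [-]
    turns-interleave-sorted t (t′ ∷ ts) (t<t′ ∷ asc) =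
      proj₁ (turn-between t<t′) ∷ proj₂ (turn-between t<t′) ∷ turns-interleave-sorted t′ ts asc

    turns-≥ : ∀ {t ts} → Ascending t ts → All (t ≤_) (turns t ts)
    turns-≥ {ts = []}    (t<n ∷ _)    = proj₁ (turn-between t<n) ∷ []
    turns-≥ {ts = _ ∷ _} (t<t′ ∷ asc) =
      proj₁ (turn-between t<t′) ∷ All.map (≤-trans (<⇒≤ t<t′)) (turns-≥ asc)

    turnsFrom-> : ∀ {t ts} → Ascending t ts → All (t <_) (turnsFrom ts)
    turnsFrom-> {ts = []}    _            = []
    turnsFrom-> {ts = _ ∷ _} (t<t′ ∷ asc) = All.map (<-≤-trans t<t′) (turns-≥ asc)

    sum-turns : ∀ t ts → Ascending t ts → sum (turns t ts) ≡ excess t ts + sum (t ∷ ts)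
    sum-turns t [] (t<n ∷ _) = begin
      turn t n + 0         ≡⟨ +-identityʳ _ ⟩
      turn t n             ≡⟨ m∸n+n≡m (proj₁ (turn-between t<n)) ⟨
      (turn t n ∸ t) + t   ≡⟨ cong ((turn t n ∸ t) +_) (+-identityʳ t) ⟨
      (turn t n ∸ t) + (t + 0) ∎
      where open ≡-Reasoning
    sum-turns t (t′ ∷ ts) (t<t′ ∷ asc) = begin
      turn t t′ + sum (turns t′ ts)
        ≡⟨ cong₂ _+_ (m∸n+n≡m (proj₁ (turn-between t<t′))) (sym (sum-turns t′ ts asc)) ⟨
      ((turn t t′ ∸ t) + t) + (excess t′ ts + sum (t′ ∷ ts))
        ≡⟨ +-interchange (turn t t′ ∸ t) t (excess t′ ts) _ ⟩
      excess t (t′ ∷ ts) + (t + sum (t′ ∷ ts))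
        ∎
      where open ≡-Reasoning

    excess-≤ : ∀ t ts → Ascending t ts → excess t ts ≤ n ∸ t
    excess-≤ t [] (t<n ∷ _) = ∸-monoˡ-≤ t (proj₂ (turn-between t<n))
    excess-≤ t (t′ ∷ ts) (t<t′ ∷ asc) = begin
      (turn t t′ ∸ t) + excess t′ ts
        ≤⟨ +-mono-≤ (∸-monoˡ-≤ t (proj₂ (turn-between t<t′))) (excess-≤ t′ ts asc) ⟩
      (t′ ∸ t) + (n ∸ t′)            ≡⟨ ∸-telescope (<⇒≤ t<t′) (<⇒≤ (ascending-<n asc)) ⟩
      n ∸ t                          ∎
      where open ≤-Reasoning

    record Neighbourhood (t : ℕ) (ts : List ℕ) (ρ : ℕ) : Set where
      field
        before after index : ℕ
        before<ρ         : before < ρ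
        ρ<after          : ρ < after
        after≤n          : after ≤ n
        countBelow-cuts  : countBelow ρ (t ∷ ts) ≡ suc index
        countBelow-turns : countBelow ρ (turns t ts) ≡ index + below (turn before ρ) ρ
        countAt-turns    : countAt ρ (turns t ts) ≡ equals (turn before ρ) ρ + equals (turn ρ after) ρ

    neighbourhood : ∀ {ρ t ts} → Ascending t ts → ρ ∈ ts → Neighbourhood t ts ρ
    neighbourhood {ρ} {t} {.ρ ∷ ts} (t<ρ ∷ asc) (here refl) = record
      { before = t ; after = next ts ; index = 0
      ; before<ρ = t<ρ ; ρ<after = ascending-next asc ; after≤n = next≤n asc
      ; countBelow-cuts = cuts
      ; countBelow-turns = below-turns
      ; countAt-turns = at-turns
      }
      where
      cuts : countBelow ρ (t ∷ ρ ∷ ts) ≡ 1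
      cuts rewrite below-< t<ρ | below-≥ (≤-refl {ρ})
                 | countBelow-≡0 (All.map <⇒≤ (All++⁻ˡ ts (ascending-all asc))) = refl
      below-turns : countBelow ρ (turns t (ρ ∷ ts)) ≡ below (turn t ρ) ρ
      below-turns rewrite below-≥ (proj₁ (turn-between (ascending-next asc)))
                        | countBelow-≡0 (All.map <⇒≤ (turnsFrom-> asc)) = +-identityʳ _
      at-turns : countAt ρ (turns t (ρ ∷ ts)) ≡ equals (turn t ρ) ρ + equals (turn ρ (next ts)) ρ
      at-turns rewrite countAt-≡0 (turnsFrom-> asc) = cong (equals (turn t ρ) ρ +_) (+-identityʳ _)
    neighbourhood {ρ} {t} {t′ ∷ ts} (t<t′ ∷ asc) (there ρ∈ts) = record
      { before = before ; after = after ; index = suc index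
      ; before<ρ = before<ρ ; ρ<after = ρ<after ; after≤n = after≤n
      ; countBelow-cuts = cuts
      ; countBelow-turns = below-turns
      ; countAt-turns = at-turns
      }
      where
      open Neighbourhood (neighbourhood asc ρ∈ts)
      t′<ρ : t′ < ρ
      t′<ρ = All.lookup (All++⁻ˡ ts (ascending-all asc)) ρ∈ts
      turn<ρ : turn t t′ < ρ
      turn<ρ = ≤-<-trans (proj₂ (turn-between t<t′)) t′<ρ
      cuts : countBelow ρ (t ∷ t′ ∷ ts) ≡ suc (suc index)
      cuts rewrite below-< (<-trans t<t′ t′<ρ) = cong suc countBelow-cuts
      below-turns : countBelow ρ (turns t (t′ ∷ ts)) ≡ suc index + below (turn before ρ) ρ
      below-turns rewrite below-< turn<ρ = cong suc countBelow-turns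
      at-turns : countAt ρ (turns t (t′ ∷ ts)) ≡ equals (turn before ρ) ρ + equals (turn ρ after) ρ
      at-turns rewrite equals-≢ (<⇒≢ turn<ρ) = countAt-turns

    module Labelled (f : ℕ → ℕ) (valley : Valley n f v)
                    (ascent-into-v : w ≤ v → v < n → f (pred v) ≤ f v)
                    (descent-into-v : v < w → 0 < v → f v < f (pred v)) where
      open Valley valley using (descent; ascent)

      data Hit (e dp dc : ℕ) : Set where
        missed         : dp ≢ suc e → dc ≢ suc e → Hit e dp dc
        hit-from-left  : dp ≡ suc e → dc ≢ suc e → f e ≤ f (suc e) → Hit e dp dc
        hit-from-right : dp < suc e → dc ≡ suc e → f (suc e) < f e → Hit e dp dc

      hit : ∀ {tp e tn} → tp < suc e → suc e < tn → tn ≤ n → Hit e (turn tp (suc e)) (turn (suc e) tn)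
      hit {tp} {e} {tn} tp<ρ ρ<tn tn≤n
        with turn tp (suc e) | turn-view tp (suc e) | turn (suc e) tn | turn-view (suc e) tn
      ... | _ | descending-gap ρ<w | _ | descending-gap tn<w with pred tn ≟ suc e
      ...   | yes eq = hit-from-right ≤-refl eq (descent e z≤n (≤-trans ρ<tn (≤-pred (≤-trans tn<w w≤1+v))))
      ...   | no ne  = missed (1+n≢n ∘ sym) ne
      hit {e = e} _ _ _ | _ | descending-gap ρ<w | _ | valley-gap _ _ with v ≟ suc e
      ... | yes refl = hit-from-right ≤-refl refl (descent-into-v ρ<w (s≤s z≤n))
      ... | no ne    = missed (1+n≢n ∘ sym) ne
      hit _ _ _ | _ | descending-gap ρ<w | _ | ascending-gap w≤ρ _ = ⊥-elim (<⇒≱ ρ<w w≤ρ)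
      hit _ ρ<tn _ | _ | ascending-gap _ w≤ρ | _ | descending-gap tn<w = ⊥-elim (<⇒≱ (<-trans ρ<tn tn<w) w≤ρ)
      hit {tp} {e} _ ρ<tn tn≤n | _ | ascending-gap w≤tp _ | _ | ascending-gap _ _ with tp ≟ e
      ... | yes refl = hit-from-left refl 1+n≢n (ascent e (≤-trans v≤w w≤tp) (≤-trans ρ<tn tn≤n))
      ... | no ne    = missed (ne ∘ suc-injective) 1+n≢n
      hit _ _ _ | _ | ascending-gap _ w≤ρ | _ | valley-gap ρ<w _ = ⊥-elim (<⇒≱ ρ<w w≤ρ)
      hit _ ρ<tn _ | _ | valley-gap _ w≤ρ | _ | descending-gap tn<w = ⊥-elim (<⇒≱ (<-trans ρ<tn tn<w) w≤ρ)
      hit {e = e} _ ρ<tn tn≤n | _ | valley-gap _ w≤ρ | _ | ascending-gap _ _ with v ≟ suc e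
      ... | yes refl = hit-from-left refl 1+n≢n (ascent-into-v w≤ρ (<-≤-trans ρ<tn tn≤n))
      ... | no ne    = missed ne 1+n≢n
      hit _ _ _ | _ | valley-gap _ w≤ρ | _ | valley-gap ρ<w _ = ⊥-elim (<⇒≱ ρ<w w≤ρ)

      turn-monotone : ∀ {t t′} → t < t′ → t′ ≤ n →
        LinkedOn _>_ f t (turn t t′) × LinkedOn _≤_ f (turn t t′) t′
      turn-monotone {t} {suc t′} _ t′≤n with turn t (suc t′) | turn-view t (suc t′)
      ... | _ | descending-gap t′<w =
        (λ e _ e+2≤t′ → descent e z≤n (≤-trans e+2≤t′ (≤-trans (n≤1+n t′) (≤-pred (≤-trans t′<w w≤1+v))))) ,
        (λ e t′≤e e+2≤ → ⊥-elim (1+n≰n (≤-trans (≤-pred e+2≤) t′≤e)))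
      ... | _ | ascending-gap w≤t _ =
        (λ e t≤e e+2≤ → ⊥-elim (1+n≰n (≤-trans (≤-pred e+2≤) t≤e))) ,
        (λ e t+1≤e e+2≤ → ascent e (≤-trans v≤w (≤-trans w≤t (≤-trans (n≤1+n t) t+1≤e))) (≤-trans e+2≤ t′≤n))
      ... | _ | valley-gap _ _ =
        (λ e _ e+2≤v → descent e z≤n e+2≤v) , (λ e v≤e e+2≤ → ascent e v≤e (≤-trans e+2≤ t′≤n))

turns-differ : ∀ {n w v v′} → v ≢ v′ → ∀ t ts → t < w → w ≤ n →
  Turns.turns n v w t ts ≢ Turns.turns n v′ w t ts
turns-differ {n} {w} {v} {v′} v≢v′ t [] t<w w≤n eq =
  v≢v′ (trans (sym (Turns.turn-valley n v w t<w w≤n))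
             (trans (∷-injectiveˡ eq) (Turns.turn-valley n v′ w t<w w≤n)))
turns-differ {n} {w} {v} {v′} v≢v′ t (t′ ∷ ts) t<w w≤n eq with <-≤-connex t′ w
... | inj₁ t′<w = turns-differ v≢v′ t′ ts t′<w w≤n (∷-injectiveʳ eq)
... | inj₂ w≤t′ = v≢v′ (trans (sym (Turns.turn-valley n v w t<w w≤t′))
                       (trans (∷-injectiveˡ eq) (Turns.turn-valley n v′ w t<w w≤t′)))

valleyTurns : ℕ → (ℕ → ℕ) → ℕ → List ℕ → List ℕ
valleyTurns n f v = Turns.turns n v (threshold n f v) 0

module _ {n : ℕ} {f : ℕ → ℕ} where

  no-ascent-before-valley : ∀ {u v} → Valley n f v → u < v → ¬ AscentInto n f u
  no-ascent-before-valley V u<v (inj₁ refl) = <⇒≱ u<v (Valley.v≤n V)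
  no-ascent-before-valley {suc u} V u<v (inj₂ (_ , le)) = <⇒≱ (Valley.descent V u z≤n u<v) le

  -- Valleys v₁ < v₂ of one label sequence are adjacent and share the threshold v₂, so their
  -- turns differ in the gap containing it.
  ordered-valleys-differ : ∀ {v₁ v₂} ts → Valley n f v₁ → Valley n f v₂ → v₁ < v₂ →
    valleyTurns n f v₁ ts ≢ valleyTurns n f v₂ ts
  ordered-valleys-differ {v₁} {v₂} ts V₁ V₂ v₁<v₂ eq
    with threshold n f v₁ | threshold-view n f v₁ | m≤n⇒m<n∨m≡n v₁<v₂
  ... | _ | at-valley asc   | _ = no-ascent-before-valley V₂ v₁<v₂ asc
  ... | _ | after-valley _  | inj₁ v₁+1<v₂ =
    <⇒≱ (Valley.descent V₂ v₁ z≤n v₁+1<v₂) (Valley.ascent V₁ v₁ ≤-refl (≤-trans v₁+1<v₂ (Valley.v≤n V₂)))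
  ... | _ | after-valley _  | inj₂ refl with threshold n f v₂ | threshold-view n f v₂
  ...   | _ | at-valley _      = turns-differ (1+n≢n ∘ sym) 0 ts (s≤s z≤n) (Valley.v≤n V₂) eq
  ...   | _ | after-valley ¬asc = ¬asc (inj₂ (s≤s z≤n , Valley.ascent V₁ v₁ ≤-refl v₁+2≤n))
    where
    v₁+2≤n : suc (suc v₁) ≤ n
    v₁+2≤n = ≤∧≢⇒< (Valley.v≤n V₂) (¬asc ∘ inj₁)

  valleyTurns-injective : ∀ {v₁ v₂} ts → Valley n f v₁ → Valley n f v₂ →
    valleyTurns n f v₁ ts ≡ valleyTurns n f v₂ ts → v₁ ≡ v₂
  valleyTurns-injective {v₁} {v₂} ts V₁ V₂ eq with <-cmp v₁ v₂
  ... | tri< v₁<v₂ _ _ = ⊥-elim (ordered-valleys-differ ts V₁ V₂ v₁<v₂ eq)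
  ... | tri≈ _ v₁≡v₂ _ = v₁≡v₂
  ... | tri> _ _ v₂<v₁ = ⊥-elim (ordered-valleys-differ ts V₂ V₁ v₂<v₁ (sym eq))

-- Maximal chains as sequences of ranks

module Chains (RP : RLabeledPoset) where
  open RLabeledPoset RP using (rank; graded; lab)
  open Main RP
  open IsGraded graded
  private module ≼ = IsPartialOrder isPartialOrder

  at : List X → ℕ → X
  at = nth 𝟘

  labelAt : List X → ℕ → ℕ
  labelAt = stepLabel 𝟘 lab

  sat-prefix : ∀ {x L y} → Sat x L y → ∀ i → i < length L → Sat x (take (suc i) L) (at L i)
  sat-prefix sat-[]      zero    _       = sat-[]
  sat-prefix (sat-∷ _ _) zero    _       = sat-[]
  sat-prefix (sat-∷ c s) (suc i) (s≤s i<) = sat-∷ c (sat-prefix s i i<)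
  sat-prefix sat-[]      (suc i) (s≤s ())

  at-≼ : ∀ {x L y} → Sat x L y → ∀ {i j} → i ≤ j → j < length L → at L i ≼ at L j
  at-≼ sat-[]      {zero}  {zero}  _         _        = ≼.refl
  at-≼ (sat-∷ _ _) {zero}  {zero}  _         _        = ≼.refl
  at-≼ (sat-∷ c s) {zero}  {suc j} _         (s≤s j<) = ≼.trans (proj₁ (proj₁ c)) (at-≼ s z≤n j<)
  at-≼ (sat-∷ c s) {suc i} {suc j} (s≤s i≤j) (s≤s j<) = at-≼ s i≤j j<
  at-≼ sat-[]      {_}     {suc j} _         (s≤s ())

  ∈⇒at : ∀ {z} L → z ∈ L → ∃[ i ] (i < length L × at L i ≡ z)
  ∈⇒at (_ ∷ _) (here refl) = 0 , s≤s z≤n , refl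
  ∈⇒at (_ ∷ L) (there z∈L) with ∈⇒at L z∈L
  ... | i , i< , eq = suc i , s≤s i< , eq

  at-∈ : ∀ L {i} → i < length L → at L i ∈ L
  at-∈ (_ ∷ _) {zero}  _        = here refl
  at-∈ (_ ∷ L) {suc i} (s≤s i<) = there (at-∈ L i<)

  module MaximalChain {L : List X} (sat : Sat 𝟘 L 𝟙) where

    length≡ : length L ≡ suc n
    length≡ = rank-chain 𝟙 L sat

    ≤n⇒< : ∀ {i} → i ≤ n → i < length L
    ≤n⇒< i≤n = subst (_ <_) (sym length≡) (s≤s i≤n)

    rank-at : ∀ {i} → i < length L → rank (at L i) ≡ i
    rank-at {i} i< = suc-injective (begin
      suc (rank (at L i))         ≡⟨ rank-chain _ _ (sat-prefix sat i i<) ⟨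
      length (take (suc i) L)     ≡⟨ length-take (suc i) L ⟩
      suc i ⊓ length L            ≡⟨ m≤n⇒m⊓n≡m i< ⟩
      suc i                       ∎)
      where open ≡-Reasoning

    ∈⇒at-rank : ∀ {z} → z ∈ L → rank z < length L × at L (rank z) ≡ z
    ∈⇒at-rank z∈L with ∈⇒at L z∈L
    ... | i , i< , refl rewrite rank-at i< = i< , refl

    rank-≤n : ∀ {z} → z ∈ L → rank z ≤ n
    rank-≤n z∈L = ≤-pred (subst (_ <_) length≡ (proj₁ (∈⇒at-rank z∈L)))

    at-≼⇒≤ : ∀ {i j} → i < length L → j < length L → at L i ≼ at L j → i ≤ j
    at-≼⇒≤ {i} {j} i< j< le with ≤-total i j
    ... | inj₁ i≤j = i≤j
    ... | inj₂ j≤i = ≤-reflexive (begin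
      i               ≡⟨ rank-at i< ⟨
      rank (at L i)   ≡⟨ cong rank (≼.antisym le (at-≼ sat j≤i i<)) ⟩
      rank (at L j)   ≡⟨ rank-at j< ⟩
      j               ∎)
      where open ≡-Reasoning

    at-≺ : ∀ {i j} → i < j → j < length L → at L i ≺ at L j
    at-≺ {i} {j} i<j j< = at-≼ sat (<⇒≤ i<j) j< ,
      λ eq → <⇒≢ i<j (trans (sym (rank-at (<-trans i<j j<))) (trans (cong rank eq) (rank-at j<)))

    ≤n⇒∈ : ∀ {i} → i ≤ n → at L i ∈ L
    ≤n⇒∈ = at-∈ L ∘ ≤n⇒<

    map-rank-at : ∀ {is} → All (_≤ n) is → map rank (map (at L) is) ≡ is
    map-rank-at []         = refl
    map-rank-at (i≤n ∷ bs) = cong₂ _∷_ (rank-at (≤n⇒< i≤n)) (map-rank-at bs)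

    at-ascending : ∀ {is} → Linked _<_ is → All (_≤ n) is → Linked _≺_ (map (at L) is)
    at-ascending []              _                = []
    at-ascending [-]             _                = [-]
    at-ascending (i<j ∷ sorted) (_ ∷ j≤n ∷ bs) = at-≺ i<j (≤n⇒< j≤n) ∷ at-ascending sorted (j≤n ∷ bs)

    at-monotone : ∀ {is} → Linked _≤_ is → All (_≤ n) is → Linked _≼_ (map (at L) is)
    at-monotone []              _                = []
    at-monotone [-]             _                = [-]
    at-monotone (i≤j ∷ sorted) (_ ∷ j≤n ∷ bs) = at-≼ sat i≤j (≤n⇒< j≤n) ∷ at-monotone sorted (j≤n ∷ bs)

    rank-monotone : ∀ {zs} → Linked _≼_ zs → All (_∈ L) zs → Linked _≤_ (map rank zs)
    rank-monotone []             _                = []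
    rank-monotone [-]            _                = [-]
    rank-monotone {y ∷ z ∷ _} (y≼z ∷ chain) (y∈L ∷ z∈L ∷ ms) with ∈⇒at-rank y∈L | ∈⇒at-rank z∈L
    ... | y< , y≡ | z< , z≡ =
      at-≼⇒≤ y< z< (subst₂ _≼_ (sym y≡) (sym z≡) y≼z) ∷ rank-monotone chain (z∈L ∷ ms)

    -- Comparing the numbers of cuts and turns below e + 1 locates the step (e, e + 1):
    -- equally many puts it in an ascending segment [d, c], one more cut in a descending [c, d].
    alternation-at : ∀ p cs ds e → length cs ≡ length ds → Linked _≤_ (p ∷ interleave cs ds ++ n ∷ []) →
      p ≤ e → ¬ suc e ∈ cs → ¬ suc e ∈ ds → suc (suc e) ≤ n → Alt L true (p ∷ interleave cs ds ++ n ∷ []) →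
      (countBelow (suc e) cs ≡ countBelow (suc e) ds → labelAt L e ≤ labelAt L (suc e)) ×
      (countBelow (suc e) cs ≡ suc (countBelow (suc e) ds) → labelAt L (suc e) < labelAt L e)
    alternation-at p [] [] e _ (p≤n ∷ _) p≤e _ _ e+2≤n (ascending , _) =
      (λ _ → linked-segment⇒ 𝟘 lab L p n p≤n (≤n⇒< ≤-refl) ascending e p≤e e+2≤n) , λ ()
    alternation-at p (c ∷ cs) (d ∷ ds) e len (p≤c ∷ c≤d ∷ sorted) p≤e e+1∉cs e+1∉ds e+2≤n
                   (ascending , descending , alternating)
      with interleave-above cs ds (suc-injective len) sorted | <-cmp (suc e) c
    ... | _ | tri≈ _ e+1≡c _ = ⊥-elim (e+1∉cs (here e+1≡c))
    ... | cs≥d , ds≥d , d≤n | tri< e+1<c _ _ =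
      (λ _ → linked-segment⇒ 𝟘 lab L p c p≤c (≤n⇒< (≤-trans c≤d d≤n)) ascending e p≤e e+1<c) ,
      λ eq → ⊥-elim (0≢1+n (trans (sym (countBelow-≡0 cs≥e+1)) (trans eq (cong suc (countBelow-≡0 ds≥e+1)))))
      where
      e+1≤d : suc e ≤ d
      e+1≤d = ≤-trans (<⇒≤ e+1<c) c≤d
      cs≥e+1 : All (suc e ≤_) (c ∷ cs)
      cs≥e+1 = <⇒≤ e+1<c ∷ All.map (≤-trans e+1≤d) cs≥d
      ds≥e+1 : All (suc e ≤_) (d ∷ ds)
      ds≥e+1 = e+1≤d ∷ All.map (≤-trans e+1≤d) ds≥d
    ... | cs≥d , ds≥d , d≤n | tri> _ _ c<e+1 with <-cmp (suc e) d
    ...   | tri≈ _ e+1≡d _ = ⊥-elim (e+1∉ds (here e+1≡d))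
    ...   | tri< e+1<d _ _ =
      (λ eq → ⊥-elim (1+n≢0 (trans (sym cs-count) (trans eq (countBelow-≡0 ds≥e+1))))) ,
      (λ _ → linked-segment⇒ 𝟘 lab L c d c≤d (≤n⇒< d≤n) descending e (≤-pred c<e+1) e+1<d)
      where
      ds≥e+1 : All (suc e ≤_) (d ∷ ds)
      ds≥e+1 = <⇒≤ e+1<d ∷ All.map (≤-trans (<⇒≤ e+1<d)) ds≥d
      cs-count : countBelow (suc e) (c ∷ cs) ≡ 1
      cs-count rewrite below-< c<e+1 | countBelow-≡0 (All.map (≤-trans (<⇒≤ e+1<d)) cs≥d) = refl
    ...   | tri> _ _ d<e+1
      with alternation-at d cs ds e (suc-injective len) sorted (≤-pred d<e+1)
                          (e+1∉cs ∘ there) (e+1∉ds ∘ there) e+2≤n alternating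
    ...     | same , more rewrite below-< c<e+1 | below-< d<e+1 = same ∘ suc-injective , more ∘ suc-injective

-- From a valley to a minimal element of B°(T)

module Construction (RP : RLabeledPoset) where
  open RLabeledPoset RP using (rank; graded; lab)
  open Main RP
  open Chains RP

  triple-≟ : (s₁ s₂ : Triple) → Dec (s₁ ≡ s₂)
  triple-≟ = ×-≡-dec (List-≡-dec Fin._≟_) (×-≡-dec (List-≡-dec Fin._≟_) (Vec-≡-dec Fin._≟_))

  chainOf : Triple → List X
  chainOf s = toList (proj₂ (proj₂ s))

  valleyOf : Triple → ℕ
  valleyOf (_ , d ∷ _ , _) = rank d
  valleyOf (_ , []    , _) = 0

  record Source (ℓ : ℕ) (s : Triple) : Set where
    field
      sat    : Sat 𝟘 (chainOf s) 𝟙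
      C≡     : proj₁ s ≡ at (chainOf s) 0 ∷ []
      D≡     : proj₁ (proj₂ s) ≡ at (chainOf s) (valleyOf s) ∷ []
      ℓ≡     : ℓ ≡ valleyOf s
      valley : Valley n (labelAt (chainOf s)) (valleyOf s)

  ranks₀-⊥ : ranks₀ ⊥ ≡ 0 ∷ []
  ranks₀-⊥ = cong (0 ∷_) (trans (members-positions ⊥) (positions-⊥ {n} 0))

  source : ∀ {ℓ} s → InA ℓ (ranks₀ ⊥) s → Source ℓ s
  source ([] , _ , _) (_ , rC , _) with trans rC ranks₀-⊥
  ... | ()
  source (_ ∷ _ ∷ _ , _ , _) (_ , rC , _) with trans rC ranks₀-⊥
  ... | ()
  source (_ ∷ [] , []        , _) (_ , _ , () , _)
  source (_ ∷ [] , _ ∷ _ ∷ _ , _) (_ , _ , () , _)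
  source {ℓ} (c ∷ [] , d ∷ [] , M)
         (_ , rC , _ , _ , sum≡ , sat , c∈ ∷ [] , d∈ ∷ [] , _ , descending , ascending , _) =
    record
      { sat    = sat
      ; C≡     = cong (_∷ []) (trans (sym (proj₂ (∈⇒at-rank c∈))) (cong (at L) rc≡0))
      ; D≡     = cong (_∷ []) (sym (proj₂ (∈⇒at-rank d∈)))
      ; ℓ≡     = +-cancelʳ-≡ 0 ℓ (rank d) (sym (trans sum≡ (cong (λ r → ℓ + (r + 0)) rc≡0)))
      ; valley = record
        { v≤n     = rank-≤n d∈
        ; descent = linked-segment⇒ 𝟘 lab L 0 (rank d) z≤n v<
                      (subst (λ i → Linked _>_ (labelsOf lab (segment L i (rank d)))) rc≡0 descending)
        ; ascent  = linked-segment⇒ 𝟘 lab L (rank d) n (rank-≤n d∈) (≤n⇒< ≤-refl) ascending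
        }
      }
    where
    L : List X
    L = toList M
    open MaximalChain sat
    rc≡0 : rank c ≡ 0
    rc≡0 = ∷-injectiveˡ (trans rC ranks₀-⊥)
    v< : rank d < length L
    v< = proj₁ (∈⇒at-rank d∈)

  module _ (T : Subset n) where

    cuts : List ℕ
    cuts = positions T 0

    thresholdOf : Triple → ℕ
    thresholdOf s = threshold n (labelAt (chainOf s)) (valleyOf s)

    target : Triple → Triple
    target s =
      map (at L) (0 ∷ cuts) , map (at L) (valleyTurns n (labelAt L) (valleyOf s) cuts) , proj₂ (proj₂ s)
      where
      L : List X
      L = chainOf s

    level : Triple → ℕ
    level s = Turns.excess n (valleyOf s) (thresholdOf s) 0 cuts

    module Target (T₀ : ∀ i → toℕ i ≡ 0 → i ∉ T) (0<n : 0 < n) {ℓ s} (src : Source ℓ s) where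
      open Source src

      L : List X
      L = chainOf s

      f : ℕ → ℕ
      f = labelAt L

      v w : ℕ
      v = valleyOf s
      w = thresholdOf s

      open MaximalChain sat
      open Turns n v w
      open Bounded (threshold-≥ n f v) (threshold-≤ n f v)
      open Labelled f valley (threshold-ascent n f v) (threshold-descent n f v)

      ds : List ℕ
      ds = turns 0 cuts

      cuts-ascending : Ascending 0 cuts
      cuts-ascending = positions-ascending₀ T 0<n T₀

      cuts-turns-sorted : Linked _≤_ (interleave (0 ∷ cuts) ds ++ n ∷ [])
      cuts-turns-sorted = turns-interleave-sorted 0 cuts cuts-ascending

      bounds : All (_≤ n) (0 ∷ cuts) × All (_≤ n) ds
      bounds = All-interleave⁻ (0 ∷ cuts) ds (sym (turns-length 0 cuts)) (Linked-≤-last _ cuts-turns-sorted)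

      ranks-C : map rank (map (at L) (0 ∷ cuts)) ≡ 0 ∷ cuts
      ranks-C = map-rank-at (proj₁ bounds)

      ranks-D : map rank (map (at L) ds) ≡ ds
      ranks-D = map-rank-at (proj₂ bounds)

      gap-alternation : ∀ {t t′} → t < t′ → t′ ≤ n →
        StrictlyDecreasing (labelsOf lab (segment L t (turn t t′))) ×
        WeaklyIncreasing (labelsOf lab (segment L (turn t t′) t′))
      gap-alternation {t} {t′} t<t′ t′≤n =
        linked-segment⇐ 𝟘 lab L t (turn t t′) t≤d (≤n⇒< (≤-trans d≤t′ t′≤n)) (proj₁ monotone) ,
        linked-segment⇐ 𝟘 lab L (turn t t′) t′ d≤t′ (≤n⇒< t′≤n) (proj₂ monotone)
        where
        t≤d : t ≤ turn t t′
        t≤d = proj₁ (turn-between t<t′)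
        d≤t′ : turn t t′ ≤ t′
        d≤t′ = proj₂ (turn-between t<t′)
        monotone : LinkedOn _>_ f t (turn t t′) × LinkedOn _≤_ f (turn t t′) t′
        monotone = turn-monotone t<t′ t′≤n

      alternation-turns : ∀ t ts → Ascending t ts → Alt L false (interleave (t ∷ ts) (turns t ts) ++ n ∷ [])
      alternation-turns t []        (t<n ∷ _)    = Product.map₂ (_, _) (gap-alternation t<n ≤-refl)
      alternation-turns t (t′ ∷ ts) (t<t′ ∷ asc) =
        Product.map₂ (_, alternation-turns t′ ts asc) (gap-alternation t<t′ (<⇒≤ (ascending-<n asc)))

      target-InA : InA (level s) (ranks₀ T) (target s)
      target-InA =
          at-ascending (Linked-init (0 ∷ cuts) cuts-ascending) (proj₁ bounds)
        , trans ranks-C (cong (0 ∷_) (sym (members-positions T)))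
        , trans (length-map _ (0 ∷ cuts)) (trans (sym (turns-length 0 cuts)) (sym (length-map _ ds)))
        , subst (Linked _≼_) (sym (interleave-map (at L) (0 ∷ cuts) ds))
            (at-monotone (Linked-init _ cuts-turns-sorted) (All-interleave⁺ (proj₁ bounds) (proj₂ bounds)))
        , subst₂ (λ cs′ ds′ → sum ds′ ≡ level s + sum cs′) (sym ranks-C) (sym ranks-D)
            (sum-turns 0 cuts cuts-ascending)
        , sat
        , All-map⁺ (All.map ≤n⇒∈ (proj₁ bounds))
        , All-map⁺ (All.map ≤n⇒∈ (proj₂ bounds))
        , subst₂ (λ cs′ ds′ → Alt L true (0 ∷ interleave cs′ ds′ ++ n ∷ [])) (sym ranks-C) (sym ranks-D)
            (linked-segment⇐ 𝟘 lab L 0 0 z≤n (≤n⇒< z≤n) (λ _ _ ()) , alternation-turns 0 cuts cuts-ascending)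

      rank-extra : ∀ S → map rank (extra S T (proj₂ (proj₂ s))) ≡ positions (T ─ S) 0
      rank-extra S = begin
        map rank (map (λ r → lookup M (inject₁ r)) (members (T ─ S))) ≡⟨ map-∘ (members (T ─ S)) ⟨
        map (λ r → rank (lookup M (inject₁ r))) (members (T ─ S))     ≡⟨ map-cong rank-lookup _ ⟩
        map toℕ (members (T ─ S))                                     ≡⟨ members-positions (T ─ S) ⟩
        positions (T ─ S) 0                                           ∎
        where
        open ≡-Reasoning
        M : Vec X (suc n)
        M = proj₂ (proj₂ s)
        rank-lookup : ∀ r → rank (lookup M (inject₁ r)) ≡ toℕ r
        rank-lookup r = trans (cong rank (trans (lookup-nth 𝟘 M (inject₁ r)) (cong (at L) (toℕ-inject₁ r))))
                              (rank-at (≤n⇒< (<⇒≤ (toℕ<n r))))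

      -- Deleting the cut ρ and one copy of ℳ_ρ among the turns leaves ρ strictly inside a
      -- segment; `hit` and the counts below ρ give that segment the wrong monotonicity.
      removal-breaks-alternation : ∀ ρ → 0 < ρ → ρ < n → ρ ∈ cuts → ∀ sS ex dsx →
        (∀ e → countBelow e cuts ≡ countBelow e sS + countBelow e ex) → ¬ ρ ∈ sS → ρ ∈ ex →
        ds ↭ dsx ++ ex → length (0 ∷ sS) ≡ length dsx →
        Linked _≤_ (0 ∷ interleave (0 ∷ sS) dsx ++ n ∷ []) →
        ¬ Alt L true (0 ∷ interleave (0 ∷ sS) dsx ++ n ∷ [])
      removal-breaks-alternation (suc e) 0<ρ ρ<n ρ∈cuts sS ex dsx split ρ∉sS ρ∈ex perm len sorted alt =
        contradiction (hit before<ρ ρ<after after≤n)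
        where
        open Neighbourhood (neighbourhood cuts-ascending ρ∈cuts)
        ρ dp dc : ℕ
        ρ  = suc e
        dp = turn before ρ
        dc = turn ρ after

        ρ∉csx : ¬ ρ ∈ 0 ∷ sS
        ρ∉csx (here ())
        ρ∉csx (there ρ∈sS) = ρ∉sS ρ∈sS

        edge : ¬ ρ ∈ dsx →
          (countBelow ρ (0 ∷ sS) ≡ countBelow ρ dsx → f e ≤ f ρ) ×
          (countBelow ρ (0 ∷ sS) ≡ suc (countBelow ρ dsx) → f ρ < f e)
        edge ρ∉dsx = alternation-at 0 (0 ∷ sS) dsx e len sorted z≤n ρ∉csx ρ∉dsx ρ<n alt

        hits : equals dp ρ + equals dc ρ ≡ countAt ρ dsx + countAt ρ ex
        hits = trans (sym countAt-turns) (trans (tally-↭ _ perm) (tally-++ _ dsx ex))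

        hit-once⇒∉ : equals dp ρ + equals dc ρ ≡ 1 → ¬ ρ ∈ dsx
        hit-once⇒∉ once ρ∈dsx =
          1+n≰n (≤-trans (+-mono-≤ (countAt-∈ ρ∈dsx) (countAt-∈ ρ∈ex)) (≤-reflexive (trans (sym hits) once)))

        cuts-below : countBelow ρ sS + countBelow ρ ex ≡ index
        cuts-below = trans (sym (split ρ))
          (suc-injective (trans (cong (_+ countBelow ρ cuts) (sym (below-< 0<ρ))) countBelow-cuts))

        dsx-below : countBelow ρ dsx ≡ countBelow ρ sS + below dp ρ
        dsx-below = +-cancelʳ-≡ (countBelow ρ ex) _ _ (begin
          countBelow ρ dsx + countBelow ρ ex                   ≡⟨ tally-++ _ dsx ex ⟨
          countBelow ρ (dsx ++ ex)                             ≡⟨ tally-↭ _ perm ⟨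
          countBelow ρ ds                                      ≡⟨ countBelow-turns ⟩
          index + below dp ρ                                   ≡⟨ cong (_+ below dp ρ) cuts-below ⟨
          countBelow ρ sS + countBelow ρ ex + below dp ρ       ≡⟨ +-right-comm (countBelow ρ sS) _ _ ⟩
          countBelow ρ sS + below dp ρ + countBelow ρ ex       ∎)
          where open ≡-Reasoning

        csx-below : countBelow ρ (0 ∷ sS) ≡ suc (countBelow ρ sS)
        csx-below = cong (_+ countBelow ρ sS) (below-< 0<ρ)

        contradiction : ¬ Hit e dp dc
        contradiction (missed dp≢ρ dc≢ρ) =
          1+n≰n (≤-trans (≤-trans (countAt-∈ ρ∈ex) (m≤n+m _ (countAt ρ dsx)))
                         (≤-reflexive (trans (sym hits) none)))
          where
          none : equals dp ρ + equals dc ρ ≡ 0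
          none rewrite equals-≢ dp≢ρ | equals-≢ dc≢ρ = refl
        contradiction (hit-from-left dp≡ρ dc≢ρ ascends) =
          <⇒≱ (proj₂ (edge (hit-once⇒∉ once)) (trans csx-below (cong suc (sym dsx-below′)))) ascends
          where
          once : equals dp ρ + equals dc ρ ≡ 1
          once rewrite dp≡ρ | equals-refl ρ | equals-≢ dc≢ρ = refl
          dsx-below′ : countBelow ρ dsx ≡ countBelow ρ sS
          dsx-below′ rewrite dsx-below | dp≡ρ | below-≥ (≤-refl {ρ}) = +-identityʳ _
        contradiction (hit-from-right dp<ρ dc≡ρ descends) =
          <⇒≱ descends (proj₁ (edge (hit-once⇒∉ once)) (trans csx-below (sym dsx-below′)))
          where
          once : equals dp ρ + equals dc ρ ≡ 1
          once rewrite dc≡ρ | equals-refl ρ | equals-≢ (<⇒≢ dp<ρ) = refl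
          dsx-below′ : countBelow ρ dsx ≡ suc (countBelow ρ sS)
          dsx-below′ rewrite dsx-below | below-< dp<ρ = +-comm _ 1

      target-minimal : ¬ (∃[ S ] (S ⊂ T × ∃[ x ] (InA (level s) (ranks₀ S) x × Phi S T x (target s))))
      target-minimal (S , (S⊆T , r , r∈T , r∉S) , (Cx , Dx , _) ,
                      (_ , rCx , lenx , chainx , _ , _ , Cx∈ , Dx∈ , altx) , refl , _ , perm) =
        removal-breaks-alternation (toℕ r) (n≢0⇒n>0 (λ r≡0 → T₀ r r≡0 r∈T)) (toℕ<n r) (positions-∈ T 0 r∈T)
          (positions S 0) (positions (T ─ S) 0) dsx split (positions-∉ S 0 r∉S)
          (positions-∈ (T ─ S) 0 (x∈p∧x∉q⇒x∈p─q r∈T r∉S)) turns-split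
          (subst (λ cs → length cs ≡ length dsx) csx≡ lengths)
          (subst (λ cs → Linked _≤_ (0 ∷ interleave cs dsx ++ n ∷ [])) csx≡ sorted)
          (subst (λ cs → Alt L true (0 ∷ interleave cs dsx ++ n ∷ [])) csx≡ altx)
        where
        dsx : List ℕ
        dsx = map rank Dx
        csx≡ : map rank Cx ≡ 0 ∷ positions S 0
        csx≡ = trans rCx (cong (0 ∷_) (members-positions S))
        split : ∀ e → countBelow e cuts ≡ countBelow e (positions S 0) + countBelow e (positions (T ─ S) 0)
        split e = trans (tally-↭ _ (positions-─ S⊆T 0)) (tally-++ _ (positions S 0) _)
        turns-split : ds ↭ dsx ++ positions (T ─ S) 0
        turns-split =
          subst₂ _↭_ ranks-D (trans (map-++ rank Dx _) (cong (dsx ++_) (rank-extra S))) (map⁺ rank perm)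
        lengths : length (map rank Cx) ≡ length dsx
        lengths = trans (length-map rank Cx) (trans lenx (sym (length-map rank Dx)))
        CDx∈ : All (_∈ L) (interleave Cx Dx)
        CDx∈ = All-interleave⁺ Cx∈ Dx∈
        sorted : Linked _≤_ (0 ∷ interleave (map rank Cx) dsx ++ n ∷ [])
        sorted = subst (λ zs → Linked _≤_ (0 ∷ zs ++ n ∷ [])) (sym (interleave-map rank Cx Dx))
          (Linked-bracket (rank-monotone chainx CDx∈) (All-map⁺ (All.map rank-≤n CDx∈)))

    module _ (T₀ : ∀ i → toℕ i ≡ 0 → i ∉ T) (0<n : 0 < n) where

      level-≤ : ∀ s → level s ≤ n
      level-≤ s = Turns.Bounded.excess-≤ n v (thresholdOf s) (threshold-≥ n f v) (threshold-≤ n f v)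
                    0 cuts (positions-ascending₀ T 0<n T₀)
        where
        f : ℕ → ℕ
        f = labelAt (chainOf s)
        v : ℕ
        v = valleyOf s

      target-injective : ∀ {ℓ₁ ℓ₂ s₁ s₂} → Source ℓ₁ s₁ → Source ℓ₂ s₂ → target s₁ ≡ target s₂ → s₁ ≡ s₂
      target-injective {s₁ = C₁ , D₁ , M} {s₂ = C₂ , D₂ , _} src₁ src₂ eq with cong (proj₂ ∘ proj₂) eq
      ... | refl = cong₂ _,_ (trans S₁.C≡ (sym S₂.C≡))
        (cong (_, M) (trans S₁.D≡ (trans (cong (λ v → at (toList M) v ∷ []) v₁≡v₂) (sym S₂.D≡))))
        where
        module S₁ = Source src₁
        module S₂ = Source src₂
        v₁≡v₂ : valleyOf (C₁ , D₁ , M) ≡ valleyOf (C₂ , D₂ , M)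
        v₁≡v₂ = valleyTurns-injective cuts S₁.valley S₂.valley
          (trans (sym (Target.ranks-D T₀ 0<n src₁))
                 (trans (cong (map rank ∘ proj₁ ∘ proj₂) eq) (Target.ranks-D T₀ 0<n src₂)))

      value-subst : ∀ {k k′} (e : k ≡ k′) (y : B° k T) → value (subst (λ j → B° j T) e y) ≡ value y
      value-subst refl _ = refl

      toB° : ∀ {ℓ} → B° ℓ ⊥ → Σ[ ℓ′ ∈ Fin (suc n) ] B° (toℕ ℓ′) T
      toB° (s , [ p ]) = Fin.fromℕ< (s≤s (level-≤ s)) ,
        subst (λ k → B° k T) (sym (toℕ-fromℕ< _))
          (target s , [ Target.target-InA T₀ 0<n (source s (proj₁ p)) ,
                        Target.target-minimal T₀ 0<n (source s (proj₁ p)) ])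

      toB°-value : ∀ {ℓ} (x : B° ℓ ⊥) → value (proj₂ (toB° x)) ≡ target (value x)
      toB°-value (s , [ _ ]) = value-subst (sym (toℕ-fromℕ< (s≤s (level-≤ s)))) _

      toB°-injective : ∀ {L} {a b : Σ[ ℓ ∈ Fin L ] B° (toℕ ℓ) ⊥} → toB° (proj₂ a) ≡ toB° (proj₂ b) → a ≡ b
      toB°-injective {a = ℓ₁ , (s₁ , [ p₁ ])} {ℓ₂ , (s₂ , [ p₂ ])} eq = Σ-≡ (toℕ-injective ℓ₁≡ℓ₂) s₁≡s₂
        where
        targets : target s₁ ≡ target s₂
        targets = trans (sym (toB°-value (s₁ , [ p₁ ])))
                        (trans (cong (value ∘ proj₂) eq) (toB°-value (s₂ , [ p₂ ])))
        s₁≡s₂ : s₁ ≡ s₂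
        s₁≡s₂ = recompute (triple-≟ s₁ s₂)
          (target-injective (source s₁ (proj₁ p₁)) (source s₂ (proj₁ p₂)) targets)
        ℓ₁≡ℓ₂ : toℕ ℓ₁ ≡ toℕ ℓ₂
        ℓ₁≡ℓ₂ = recompute (toℕ ℓ₁ ≟ toℕ ℓ₂)
          (trans (Source.ℓ≡ (source s₁ (proj₁ p₁)))
                 (trans (cong valleyOf s₁≡s₂) (sym (Source.ℓ≡ (source s₂ (proj₁ p₂))))))
        Σ-≡ : ∀ {L} {ℓ₁ ℓ₂ : Fin L} {x₁ : B° (toℕ ℓ₁) ⊥} {x₂ : B° (toℕ ℓ₂) ⊥} →
          ℓ₁ ≡ ℓ₂ → value x₁ ≡ value x₂ → (ℓ₁ , x₁) ≡ (ℓ₂ , x₂)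
        Σ-≡ {ℓ₁ = ℓ} refl values = cong (ℓ ,_) (value-injective values)

      embedding : ∀ {L} → (Σ[ ℓ ∈ Fin L ] B° (toℕ ℓ) ⊥) ↣ (Σ[ ℓ′ ∈ Fin (suc n) ] B° (toℕ ℓ′) T)
      embedding = mk↣ toB°-injective

lemma3p13 : (P : RLabeledPoset) (T : Subset (Main.n P))
    → (∀ i → toℕ i ≡ 0 → i ∉ T)
    → (bT b∅ : ℕ → ℕ)
    → (∀ ℓ → HasCard (Main.B° P ℓ T) (bT ℓ))
    → (∀ ℓ → HasCard (Main.B° P ℓ ⊥) (b∅ ℓ))
    → ∀ L → ∃[ L′ ] (sum (applyUpTo b∅ L) ≤ sum (applyUpTo bT L′))
lemma3p13 P T T₀ bT b∅ cardT card∅ L with Main.n P ≟ 0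
... | yes n≡0 = L , sum-≤-of-injection card∅ cardT
      (subst (λ U → (Σ[ ℓ ∈ Fin L ] Main.B° P (toℕ ℓ) ⊥) ↣ (Σ[ ℓ ∈ Fin L ] Main.B° P (toℕ ℓ) U))
             (sym (Subset-0≡⊥ T n≡0)) ↣-refl)
... | no n≢0  = suc (Main.n P) ,
      sum-≤-of-injection card∅ cardT (Construction.embedding P T T₀ (n≢0⇒n>0 n≢0) {L})
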